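{- Let $G$ be a weakly triangulated graph and $T\subseteq V(G)$ such that $G[T]$ is anticonnected and $C(T)$ contains at least two non-adjacent vertices, and suppose $T$ is inclusion-wise maximal with respect to these properties. Then every induced path of $G\setminus T$ whose two ends are in $C(T)$ has all its vertices in $C(T)$.
   Context: A hole is an induced cycle of length at least 4; an antihole is the complement of a hole; a hole or antihole is long if it has at least 5 vertices. A graph is weakly triangulated if it contains no long hole and no long antihole as an induced subgraph. A graph is anticonnected if its complement is connected. For $T\subseteq V(G)$, $C(T)$ is the set of vertices of $V(G)\setminus T$ adjacent to every vertex of $T$. -}

module Defs where

open import Data.Nat using (ℕ; zero; suc; _≤_)
open import Data.Fin using (Fin; toℕ; fromℕ)
open import Data.Fin.Subset using (Subset; _∈_; _∉_; _⊆_)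
open import Data.Product using (Σ; _×_; _,_; ∃)
open import Data.Sum using (_⊎_)
open import Relation.Nullary using (¬_)
open import Relation.Binary.PropositionalEquality using (_≡_; _≢_)
open import Relation.Binary using (Decidable)
open import Function.Definitions using (Injective)

record Graph (n : ℕ) : Set₁ where
  field
    Adj     : Fin n → Fin n → Set
    adj?    : Decidable Adj
    sym     : ∀ {x y} → Adj x y → Adj y x
    irrefl  : ∀ {x} → ¬ Adj x x
open Graph public

CycConsec : ∀ {k} → Fin k → Fin k → Set
CycConsec {k} i j =
  suc (toℕ i) ≡ toℕ j ⊎ suc (toℕ j) ≡ toℕ i
  ⊎ (toℕ i ≡ 0 × suc (toℕ j) ≡ k) ⊎ (toℕ j ≡ 0 × suc (toℕ i) ≡ k)

PathConsec : ∀ {k} → Fin k → Fin k → Set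
PathConsec i j = suc (toℕ i) ≡ toℕ j ⊎ suc (toℕ j) ≡ toℕ i

HasLongHole : ∀ {n} → Graph n → Set
HasLongHole {n} G =
  Σ ℕ λ k → 5 ≤ k × Σ (Fin k → Fin n) λ v → Injective _≡_ _≡_ v ×
    (∀ i j → (Adj G (v i) (v j) → CycConsec i j) × (CycConsec i j → Adj G (v i) (v j)))

HasLongAntihole : ∀ {n} → Graph n → Set
HasLongAntihole {n} G =
  Σ ℕ λ k → 5 ≤ k × Σ (Fin k → Fin n) λ v → Injective _≡_ _≡_ v ×
    (∀ i j → i ≢ j →
      (Adj G (v i) (v j) → ¬ CycConsec i j) × (¬ CycConsec i j → Adj G (v i) (v j)))

WeaklyTriangulated : ∀ {n} → Graph n → Set
WeaklyTriangulated G = ¬ HasLongHole G × ¬ HasLongAntihole G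

data AntiWalk {n} (G : Graph n) (T : Subset n) : Fin n → Fin n → Set where
  here : ∀ {x} → AntiWalk G T x x
  step : ∀ {x y z} → z ∈ T → x ≢ z → ¬ Adj G x z → AntiWalk G T z y → AntiWalk G T x y

Anticonnected : ∀ {n} → Graph n → Subset n → Set
Anticonnected G T = (∃ λ x → x ∈ T) × (∀ x y → x ∈ T → y ∈ T → AntiWalk G T x y)

InC : ∀ {n} → Graph n → Subset n → Fin n → Set
InC G T v = v ∉ T × (∀ t → t ∈ T → Adj G v t)

Good : ∀ {n} → Graph n → Subset n → Set
Good G T = Anticonnected G T ×
  Σ _ λ a → Σ _ λ b → InC G T a × InC G T b × a ≢ b × ¬ Adj G a b

MaximalGood : ∀ {n} → Graph n → Subset n → Set
MaximalGood G T = Good G T × (∀ T' → T ⊆ T' → Good G T' → T' ⊆ T)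

IsInducedPath : ∀ {n} → Graph n → (k : ℕ) → (Fin (suc k) → Fin n) → Set
IsInducedPath G k p = Injective _≡_ _≡_ p ×
  (∀ i j → (Adj G (p i) (p j) → PathConsec i j) × (PathConsec i j → Adj G (p i) (p j)))

module Submission where

-- A vertex of the path outside C(T) lies strictly inside a stretch x 0, …, x m whose ends
-- are in C(T) and whose inner vertices are not; m ≥ 2.  If m = 2, then x 1 has a
-- non-neighbour in T, so T ∪ {x 1} is still anticonnected and x 0, x 2 are non-adjacent
-- vertices of C(T ∪ {x 1}), against the maximality of T.  If m ≥ 3, the absence of long
-- holes forces every vertex of T missing x 2 to see x 3.  As T is anticonnected, there is
-- an induced path x 1 = g 0, …, g M = x 2 of the complement through T; extended by x 0 it
-- stays induced in the complement, and there x 3 sees both its ends but neither g (M - 1)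
-- nor g M.  So x 3 closes a long hole of the complement, that is, a long antihole of G.

open import Defs hiding (sym)
open import Data.Nat using (ℕ; zero; suc; _+_; _≤_; _<_; z≤n; s≤s; s≤s⁻¹; _≤‴_; ≤‴-refl; ≤‴-step; _≤?_; _<?_)
open import Data.Nat.Properties hiding (_≟_)
open import Algebra.Properties.CommutativeSemigroup +-commutativeSemigroup using (xy∙z≈xz∙y)
open import Data.Nat.Induction using (<-rec)
open import Data.Fin using (Fin; zero; toℕ; fromℕ; fromℕ<; _≟_)
open import Data.Fin.Properties using (toℕ-injective; toℕ<n; toℕ-fromℕ<; fromℕ<-toℕ; toℕ-fromℕ; all?; ¬∀⟶∃¬)
open import Data.Fin.Subset using (Subset; _∈_; _∉_; _⊆_; _∪_; ⁅_⁆)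
open import Data.Fin.Subset.Properties using (_∈?_; x∈p∪q⁻; x∈p∪q⁺; p⊆p∪q; x∈⁅x⁆; x∈⁅y⁆⇔x≡y)
open import Data.Product using (∃; ∃₂; _×_; _,_; proj₁; proj₂)
open import Data.Sum using (_⊎_; inj₁; inj₂; [_,_]; map₂)
open import Function using (_∘_; _$_)
open import Relation.Nullary using (¬_; Dec; yes; no; contradiction)
open import Relation.Nullary.Decidable using (¬?; _×-dec_; _→-dec_; decidable-stable)
open import Relation.Unary using (Decidable)
open import Relation.Binary.PropositionalEquality using (_≡_; _≢_; refl; sym; trans; cong; subst; subst₂; ≢-sym; module ≡-Reasoning)
open import Relation.Binary using (tri<; tri≈; tri>)
open import Function.Definitions using (Injective)
open import Function.Bundles using (Equivalence)

m≤1+n⇒m≤n⊎m≡1+n : ∀ {m n} → m ≤ suc n → m ≤ n ⊎ m ≡ suc n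
m≤1+n⇒m≤n⊎m≡1+n m≤1+n with m≤n⇒m<n∨m≡n m≤1+n
... | inj₁ m<1+n = inj₁ (s≤s⁻¹ m<1+n)
... | inj₂ m≡1+n = inj₂ m≡1+n

module _ {Q : ℕ → Set} (Q? : Decidable Q) where

  first-above : ∀ {s N} → s ≤ N → ¬ Q s → Q N →
    ∃ λ e → s < e × e ≤ N × Q e × (∀ l → s ≤ l → l < e → ¬ Q l)
  first-above s≤N = go (≤⇒≤‴ s≤N)
    where
    go : ∀ {s N} → s ≤‴ N → ¬ Q s → Q N →
      ∃ λ e → s < e × e ≤ N × Q e × (∀ l → s ≤ l → l < e → ¬ Q l)
    go ≤‴-refl ¬Qs QN = contradiction QN ¬Qs
    go {s} (≤‴-step s<N) ¬Qs QN with Q? (suc s)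
    ... | yes Qs+1 = suc s , ≤-refl , ≤‴⇒≤ s<N , Qs+1 ,
          λ l s≤l l<s+1 → subst (¬_ ∘ Q) (≤-antisym s≤l (s≤s⁻¹ l<s+1)) ¬Qs
    ... | no ¬Qs+1 with go s<N ¬Qs+1 QN
    ...   | e , s+1<e , e≤N , Qe , below = e , <-trans (n<1+n s) s+1<e , e≤N , Qe ,
            λ l s≤l l<e → [ (λ s<l → below l s<l l<e) , (λ { refl → ¬Qs }) ] (m≤n⇒m<n∨m≡n s≤l)

  last-below : ∀ {N} → ¬ Q 0 → Q N → ∃ λ j → j < N × ¬ Q j × (∀ l → j < l → l ≤ N → Q l)
  last-below {zero} ¬Q0 Q0 = contradiction Q0 ¬Q0
  last-below {suc N} ¬Q0 QN+1 with Q? N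
  ... | no ¬QN = N , ≤-refl , ¬QN , λ l N<l l≤N+1 → subst Q (≤-antisym N<l l≤N+1) QN+1
  ... | yes QN with last-below ¬Q0 QN
  ...   | j , j<N , ¬Qj , above = j , m<n⇒m<1+n j<N , ¬Qj ,
          λ l j<l l≤N+1 → [ (λ l<N+1 → above l j<l (s≤s⁻¹ l<N+1)) , (λ { refl → QN+1 }) ] (m≤n⇒m<n∨m≡n l≤N+1)

gap-around : ∀ {Q : ℕ → Set} → Decidable Q → ∀ {l N} → Q 0 → Q N → ¬ Q l → l ≤ N →
  ∃₂ λ j m → j < l × l < j + m × j + m ≤ N × Q j × Q (j + m) × (∀ i → 0 < i → i < m → ¬ Q (j + i))
gap-around {Q} Q? {l} Q0 QN ¬Ql l≤N with last-below (¬? ∘ Q?) (λ ¬Q0 → ¬Q0 Q0) ¬Ql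
                                  | first-above Q? l≤N ¬Ql QN
... | j , j<l , ¬¬Qj , ¬Q-above-j | e , l<e , e≤N , Qe , ¬Q-below-e
  with m≤n⇒∃[o]m+o≡n (<⇒≤ (<-trans j<l l<e))
...   | m , refl = j , m , j<l , l<e , e≤N , decidable-stable (Q? j) ¬¬Qj , Qe , between
  where
  between : ∀ i → 0 < i → i < m → ¬ Q (j + i)
  between i 0<i i<m with j + i ≤? l
  ... | yes j+i≤l = ¬Q-above-j (j + i) (m<m+n j 0<i) j+i≤l
  ... | no j+i≰l  = ¬Q-below-e (j + i) (<⇒≤ (≰⇒> j+i≰l)) (+-monoʳ-< j i<m)

AllInner : {A : Set} → (A → Set) → (ℕ → A) → ℕ → Set
AllInner P f L = ∀ l → 0 < l → l < L → P (f l)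

Distinct : {A : Set} → (ℕ → A) → ℕ → Set
Distinct f M = ∀ a b → a < b → b ≤ M → f a ≢ f b

bypass-kept : ∀ a d r {l} → l ≤ a → l < suc (suc a + d) + r
bypass-kept a d r l≤a = s≤s (≤-trans l≤a (m≤n⇒m≤1+n (≤-trans (m≤m+n a d) (m≤m+n (a + d) r))))

bypass-shift : ∀ a d r {l} → l < suc a + r → suc (l + d) ≤ suc a + d + r
bypass-shift a d r {l} l<a+r+1 = subst (suc (l + d) ≤_) (xy∙z≈xz∙y (suc a) r d) (+-monoˡ-≤ d l<a+r+1)

module _ {A : Set} where

  snoc : (ℕ → A) → ℕ → A → ℕ → A
  snoc f M t l with l ≤? M
  ... | yes _ = f l
  ... | no _  = t

  snoc-≤ : ∀ f M t {l} → l ≤ M → snoc f M t l ≡ f l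
  snoc-≤ f M t {l} l≤M with l ≤? M
  ... | yes _   = refl
  ... | no l≰M = contradiction l≤M l≰M

  snoc-suc : ∀ f M t → snoc f M t (suc M) ≡ t
  snoc-suc f M t with suc M ≤? M
  ... | yes M+1≤M = contradiction M+1≤M 1+n≰n
  ... | no _      = refl

  Distinct-snoc : ∀ {f : ℕ → A} {M t} → Distinct f M → (∀ l → l ≤ M → f l ≢ t) → Distinct (snoc f M t) (suc M)
  Distinct-snoc {f = f} {M} {t} distinct f≢t a b a<b b≤M+1 with m≤1+n⇒m≤n⊎m≡1+n b≤M+1
  ... | inj₁ b≤M rewrite snoc-≤ f M t (≤-trans (<⇒≤ a<b) b≤M) | snoc-≤ f M t b≤M = distinct a b a<b b≤M
  ... | inj₂ refl rewrite snoc-≤ f M t (s≤s⁻¹ a<b) | snoc-suc f M t = f≢t a (s≤s⁻¹ a<b)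

  bypass : (ℕ → A) → ℕ → ℕ → ℕ → A
  bypass f a d l with l ≤? a
  ... | yes _ = f l
  ... | no _  = f (suc (l + d))

  bypass-≤ : ∀ f a d {l} → l ≤ a → bypass f a d l ≡ f l
  bypass-≤ f a d {l} l≤a with l ≤? a
  ... | yes _   = refl
  ... | no l≰a = contradiction l≤a l≰a

  bypass-> : ∀ f a d {l} → a < l → bypass f a d l ≡ f (suc (l + d))
  bypass-> f a d {l} a<l with l ≤? a
  ... | yes l≤a = contradiction l≤a (<⇒≱ a<l)
  ... | no _    = refl

  bypass-last : ∀ f a d r → bypass f a d (suc a + r) ≡ f (suc (suc a + d) + r)
  bypass-last f a d r = trans (bypass-> f a d (s≤s (m≤m+n a r))) (cong (f ∘ suc) (xy∙z≈xz∙y (suc a) r d))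

  AllInner-bypass : ∀ {P : A → Set} {f} a d r → AllInner P f (suc (suc a + d) + r) → AllInner P (bypass f a d) (suc a + r)
  AllInner-bypass {P} {f} a d r inner l 0<l l<a+r+1 with l ≤? a
  ... | yes l≤a = inner l 0<l (bypass-kept a d r l≤a)
  ... | no _    = inner (suc (l + d)) (s≤s z≤n) (s≤s (bypass-shift a d r l<a+r+1))

complement : ∀ {n} → Graph n → Graph n
complement G = record
  { Adj    = λ x y → x ≢ y × ¬ Adj G x y
  ; adj?   = λ x y → ¬? (x ≟ y) ×-dec ¬? (adj? G x y)
  ; sym    = λ (x≢y , ¬x~y) → ≢-sym x≢y , ¬x~y ∘ Graph.sym G
  ; irrefl = λ (x≢x , _) → x≢x refl
  }

HasLongHole-complement⇒HasLongAntihole : ∀ {n} (G : Graph n) → HasLongHole (complement G) → HasLongAntihole G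
HasLongHole-complement⇒HasLongAntihole G (k , 5≤k , v , v-injective , induced) =
  k , 5≤k , v , v-injective , λ i j i≢j →
    (λ vi~vj consec → proj₂ (proj₂ (induced i j) consec) vi~vj) ,
    (λ ¬consec → decidable-stable (adj? G (v i) (v j))
                   λ ¬vi~vj → ¬consec (proj₁ (induced i j) (i≢j ∘ v-injective , ¬vi~vj)))

-- for a < b: a and b are consecutive on the cycle 0, 1, …, K - 1, 0
CycStep : ℕ → ℕ → ℕ → Set
CycStep K a b = suc a ≡ b ⊎ (a ≡ 0 × suc b ≡ K)

module _ {n} (H : Graph n) where

  Walk : (ℕ → Fin n) → ℕ → Set
  Walk f L = ∀ a → a < L → Adj H (f a) (f (suc a))

  -- IsInducedPath, indexed by ℕ instead of Fin (suc M)
  record InducedPath (f : ℕ → Fin n) (M : ℕ) : Set where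
    field
      distinct  : Distinct f M
      chordless : ∀ a b → a < b → b ≤ M → Adj H (f a) (f b) → suc a ≡ b
      walk      : Walk f M

  cycle⇒HasLongHole : ∀ K → 5 ≤ K → (g : ℕ → Fin n) →
    (∀ a b → a < b → b < K → g a ≢ g b) →
    (∀ a b → a < b → b < K → Adj H (g a) (g b) → CycStep K a b) →
    (∀ a b → a < b → b < K → CycStep K a b → Adj H (g a) (g b)) →
    HasLongHole H
  cycle⇒HasLongHole K 5≤K g distinct adj⇒step step⇒adj =
    K , 5≤K , v , v-injective , adj⇔consec
    where
    v : Fin K → Fin n
    v = g ∘ toℕ
    v-injective : Injective _≡_ _≡_ v
    v-injective {i} {j} vi≡vj with <-cmp (toℕ i) (toℕ j)
    ... | tri< i<j _ _ = contradiction vi≡vj (distinct _ _ i<j (toℕ<n j))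
    ... | tri≈ _ i≡j _ = toℕ-injective i≡j
    ... | tri> _ _ j<i = contradiction (sym vi≡vj) (distinct _ _ j<i (toℕ<n i))
    CycConsec-sym : ∀ {i j : Fin K} → CycConsec i j → CycConsec j i
    CycConsec-sym (inj₁ e)               = inj₂ (inj₁ e)
    CycConsec-sym (inj₂ (inj₁ e))        = inj₁ e
    CycConsec-sym (inj₂ (inj₂ (inj₁ p))) = inj₂ (inj₂ (inj₂ p))
    CycConsec-sym (inj₂ (inj₂ (inj₂ p))) = inj₂ (inj₂ (inj₁ p))
    1<K : 1 < K
    1<K = ≤-trans (s≤s (s≤s z≤n)) 5≤K
    ¬CycConsec-refl : ∀ (i : Fin K) → ¬ CycConsec i i
    ¬CycConsec-refl i (inj₁ e)                      = 1+n≢n e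
    ¬CycConsec-refl i (inj₂ (inj₁ e))               = 1+n≢n e
    ¬CycConsec-refl i (inj₂ (inj₂ (inj₁ (i≡0 , e)))) = <⇒≢ 1<K (trans (cong suc (sym i≡0)) e)
    ¬CycConsec-refl i (inj₂ (inj₂ (inj₂ (i≡0 , e)))) = <⇒≢ 1<K (trans (cong suc (sym i≡0)) e)
    ascending : ∀ i j → toℕ i < toℕ j →
      (Adj H (v i) (v j) → CycConsec i j) × (CycConsec i j → Adj H (v i) (v j))
    ascending i j i<j = to , from
      where
      to : Adj H (v i) (v j) → CycConsec i j
      to vi~vj = [ inj₁ , inj₂ ∘ inj₂ ∘ inj₁ ] (adj⇒step _ _ i<j (toℕ<n j) vi~vj)
      from : CycConsec i j → Adj H (v i) (v j)
      from (inj₁ e)                     = step⇒adj _ _ i<j (toℕ<n j) (inj₁ e)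
      from (inj₂ (inj₁ e))              = contradiction (<-trans (n<1+n _) (subst (_< toℕ j) (sym e) i<j)) (n≮n _)
      from (inj₂ (inj₂ (inj₁ p)))       = step⇒adj _ _ i<j (toℕ<n j) (inj₂ p)
      from (inj₂ (inj₂ (inj₂ (j≡0 , _)))) = contradiction (subst (toℕ i <_) j≡0 i<j) λ ()
    adj⇔consec : ∀ i j → (Adj H (v i) (v j) → CycConsec i j) × (CycConsec i j → Adj H (v i) (v j))
    adj⇔consec i j with <-cmp (toℕ i) (toℕ j)
    ... | tri< i<j _ _ = ascending i j i<j
    ... | tri> _ _ j<i = let to , from = ascending j i j<i in
                         CycConsec-sym ∘ to ∘ Graph.sym H , Graph.sym H ∘ from ∘ CycConsec-sym
    ... | tri≈ _ i≡j _ with toℕ-injective i≡j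
    ...   | refl = (λ vi~vi → contradiction vi~vi (irrefl H)) , (λ c → contradiction c (¬CycConsec-refl i))

  Walk-snoc : ∀ {f L t} → Walk f L → Adj H (f L) t → Walk (snoc f L t) (suc L)
  Walk-snoc {f} {L} {t} w fL~t a a<L+1 with m≤1+n⇒m≤n⊎m≡1+n a<L+1
  ... | inj₁ a<L rewrite snoc-≤ f L t (<⇒≤ a<L) | snoc-≤ f L t a<L = w a a<L
  ... | inj₂ refl rewrite snoc-≤ f L t (≤-refl {L}) | snoc-suc f L t = fL~t

  InducedPath-snoc : ∀ {f M t} → InducedPath f M → (∀ l → l ≤ M → f l ≢ t) →
    Adj H (f M) t → (∀ l → l < M → ¬ Adj H (f l) t) → InducedPath (snoc f M t) (suc M)
  InducedPath-snoc {f} {M} {t} ip f≢t fM~t ¬f~t = record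
    { distinct = Distinct-snoc distinct f≢t ; chordless = chordless′ ; walk = Walk-snoc walk fM~t }
    where
    open InducedPath ip
    chordless′ : ∀ a b → a < b → b ≤ suc M → Adj H (snoc f M t a) (snoc f M t b) → suc a ≡ b
    chordless′ a b a<b b≤M+1 with m≤1+n⇒m≤n⊎m≡1+n b≤M+1
    ... | inj₁ b≤M rewrite snoc-≤ f M t (≤-trans (<⇒≤ a<b) b≤M) | snoc-≤ f M t b≤M = chordless a b a<b b≤M
    ... | inj₂ refl rewrite snoc-≤ f M t (s≤s⁻¹ a<b) | snoc-suc f M t =
      [ (λ a<M fa~t → contradiction fa~t (¬f~t a a<M)) , (λ a≡M _ → cong suc a≡M) ] (m≤n⇒m<n∨m≡n (s≤s⁻¹ a<b))

  InducedPath-drop : ∀ {f M} σ {M′} → InducedPath f M → σ + M′ ≤ M → InducedPath (λ l → f (σ + l)) M′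
  InducedPath-drop {f} {M} σ {M′} ip σ+M′≤M = record
    { distinct  = λ a b a<b b≤M′ → distinct _ _ (+-monoʳ-< σ a<b) (shifted b≤M′)
    ; chordless = λ a b a<b b≤M′ fa~fb →
        +-cancelˡ-≡ σ _ _ (trans (+-suc σ a) (chordless _ _ (+-monoʳ-< σ a<b) (shifted b≤M′) fa~fb))
    ; walk      = λ a a<M′ → subst (Adj H (f (σ + a)) ∘ f) (sym (+-suc σ a))
                    (walk (σ + a) (subst (_≤ M) (+-suc σ a) (shifted a<M′)))
    }
    where
    open InducedPath ip
    shifted : ∀ {b} → b ≤ M′ → σ + b ≤ M
    shifted b≤M′ = ≤-trans (+-monoʳ-≤ σ b≤M′) σ+M′≤M

  closed-InducedPath⇒HasLongHole : ∀ {f M t} → InducedPath f M → 3 ≤ M → (∀ l → l ≤ M → f l ≢ t) →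
    Adj H (f 0) t → Adj H (f M) t → (∀ l → 0 < l → l < M → ¬ Adj H (f l) t) → HasLongHole H
  closed-InducedPath⇒HasLongHole {f} {M} {t} ip 3≤M f≢t f0~t fM~t ¬f~t =
    cycle⇒HasLongHole (suc (suc M)) (s≤s (s≤s 3≤M)) (snoc f M t)
      (λ a b a<b → Distinct-snoc distinct f≢t a b a<b ∘ s≤s⁻¹) adj⇒step step⇒adj
    where
    open InducedPath ip
    g : ℕ → Fin n
    g = snoc f M t
    adj⇒step : ∀ a b → a < b → b < suc (suc M) → Adj H (g a) (g b) → CycStep (suc (suc M)) a b
    adj⇒step a b a<b b<M+2 with m≤1+n⇒m≤n⊎m≡1+n (s≤s⁻¹ b<M+2)
    ... | inj₁ b≤M rewrite snoc-≤ f M t (≤-trans (<⇒≤ a<b) b≤M) | snoc-≤ f M t b≤M =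
      inj₁ ∘ chordless a b a<b b≤M
    ... | inj₂ refl rewrite snoc-≤ f M t (s≤s⁻¹ a<b) | snoc-suc f M t = last-edge a (s≤s⁻¹ a<b)
      where
      last-edge : ∀ a → a ≤ M → Adj H (f a) t → CycStep (suc (suc M)) a (suc M)
      last-edge zero    _       _     = inj₂ (refl , refl)
      last-edge (suc a) a+1≤M fa~t with m≤n⇒m<n∨m≡n a+1≤M
      ... | inj₁ a+1<M = contradiction fa~t (¬f~t (suc a) (s≤s z≤n) a+1<M)
      ... | inj₂ a+1≡M = inj₁ (cong suc a+1≡M)
    step⇒adj : ∀ a b → a < b → b < suc (suc M) → CycStep (suc (suc M)) a b → Adj H (g a) (g b)
    step⇒adj a b a<b b<M+2 s with m≤1+n⇒m≤n⊎m≡1+n (s≤s⁻¹ b<M+2)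
    step⇒adj a b a<b b<M+2 (inj₁ refl) | inj₁ b≤M
      rewrite snoc-≤ f M t (<⇒≤ b≤M) | snoc-≤ f M t b≤M = walk a b≤M
    step⇒adj a b a<b b<M+2 (inj₂ (_ , refl)) | inj₁ b≤M = contradiction b≤M 1+n≰n
    step⇒adj a b a<b b<M+2 (inj₁ refl) | inj₂ refl
      rewrite snoc-≤ f M t (≤-refl {M}) | snoc-suc f M t = fM~t
    step⇒adj a b a<b b<M+2 (inj₂ (refl , _)) | inj₂ refl
      rewrite snoc-≤ f M t (z≤n {M}) | snoc-suc f M t = f0~t

  -- The last neighbour of t before f i and its first one after f (i + 1) are at least
  -- three steps apart, so together with t they bound a hole of length at least 5.
  apex⇒HasLongHole : ∀ {f M t i} → InducedPath f M → (∀ l → l ≤ M → f l ≢ t) →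
    Adj H (f 0) t → Adj H (f M) t → ¬ Adj H (f i) t → ¬ Adj H (f (suc i)) t → i < M → HasLongHole H
  apex⇒HasLongHole {f} {M} {t} {i} ip f≢t f0~t fM~t ¬fi~t ¬fi+1~t i<M
    with gap-around (λ l → adj? H (f l) t) f0~t fM~t ¬fi~t (<⇒≤ i<M)
  ... | j , m , j<i , i<j+m , j+m≤M , fj~t , fj+m~t , gap =
    closed-InducedPath⇒HasLongHole (InducedPath-drop j ip j+m≤M) 3≤m
      (λ l l≤m → f≢t (j + l) (≤-trans (+-monoʳ-≤ j l≤m) j+m≤M))
      (subst (λ z → Adj H (f z) t) (sym (+-identityʳ j)) fj~t) fj+m~t gap
    where
    i+1<j+m : suc i < j + m
    i+1<j+m = ≤∧≢⇒< i<j+m (λ e → ¬fi+1~t (subst (λ z → Adj H (f z) t) (sym e) fj+m~t))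
    3≤m : 3 ≤ m
    3≤m = +-cancelˡ-≤ j 3 m (subst (_≤ j + m) (+-comm 3 j) (≤-trans (s≤s (s≤s j<i)) i+1<j+m))

  Walk-bypass : ∀ {f} a d r → Walk f (suc (suc a + d) + r) → Adj H (f a) (f (suc (suc a + d))) →
    Walk (bypass f a d) (suc a + r)
  Walk-bypass {f} a d r w fa~fb l l<a+r+1 with <-cmp l a
  ... | tri< l<a _ _ rewrite bypass-≤ f a d (<⇒≤ l<a) | bypass-≤ f a d l<a =
    w l (bypass-kept a d r (<⇒≤ l<a))
  ... | tri≈ _ refl _ rewrite bypass-≤ f l d (≤-refl {l}) | bypass-> f l d (n<1+n l) = fa~fb
  ... | tri> _ _ a<l rewrite bypass-> f a d a<l | bypass-> f a d (m<n⇒m<1+n a<l) =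
    w (suc (l + d)) (s≤s (bypass-shift a d r l<a+r+1))

  Chord : (ℕ → Fin n) → ℕ → Set
  Chord f L = ∃ λ b → b < suc L × ∃ λ a → a < b × suc a < b × Adj H (f a) (f b)

  chord? : ∀ f L → Dec (Chord f L)
  chord? f L = anyUpTo? (λ b → anyUpTo? (λ a → suc a <? b ×-dec adj? H (f a) (f b)) b) (suc L)

  -- A walk without chords is already a path: f a ≡ f b with b < L would give the chord
  -- (a, b + 1), and f a ≡ f L is excluded by the hypotheses.  Bypassing a chord shortens it.
  Walk⇒InducedPath : ∀ {P : Fin n → Set} L f → Walk f L → f 0 ≢ f L → ¬ P (f L) → AllInner P f L →
    ∃₂ λ M g → InducedPath g M × g 0 ≡ f 0 × g M ≡ f L × AllInner P g M
  Walk⇒InducedPath {P} = <-rec Shortenable shorten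
    where
    Shortenable : ℕ → Set
    Shortenable L = ∀ f → Walk f L → f 0 ≢ f L → ¬ P (f L) → AllInner P f L →
      ∃₂ λ M g → InducedPath g M × g 0 ≡ f 0 × g M ≡ f L × AllInner P g M
    shorten : ∀ L → (∀ {L′} → L′ < L → Shortenable L′) → Shortenable L
    shorten L rec f w f0≢fL ¬PfL inner with chord? f L
    ... | no ¬chord = L , f , record { distinct = distinct ; chordless = chordless ; walk = w } , refl , refl , inner
      where
      ≢last : ∀ a → a < L → f a ≢ f L
      ≢last zero     _   = f0≢fL
      ≢last (suc a) a<L fa≡fL = ¬PfL (subst P fa≡fL (inner (suc a) (s≤s z≤n) a<L))
      distinct : Distinct f L
      distinct a b a<b b≤L fa≡fb with m≤n⇒m<n∨m≡n b≤L
      ... | inj₂ refl = ≢last a a<b fa≡fb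
      ... | inj₁ b<L  = ¬chord (suc b , s≤s b<L , a , m<n⇒m<1+n a<b , s≤s a<b ,
                                subst (λ z → Adj H z (f (suc b))) (sym fa≡fb) (w b b<L))
      chordless : ∀ a b → a < b → b ≤ L → Adj H (f a) (f b) → suc a ≡ b
      chordless a b a<b b≤L fa~fb with m≤n⇒m<n∨m≡n a<b
      ... | inj₁ a+1<b = contradiction (b , s≤s b≤L , a , a<b , a+1<b , fa~fb) ¬chord
      ... | inj₂ a+1≡b = a+1≡b
    ... | yes (b , b<L+1 , a , _ , a+1<b , fa~fb) with m≤n⇒∃[o]m+o≡n a+1<b
    ...   | d , refl with m≤n⇒∃[o]m+o≡n (s≤s⁻¹ b<L+1)
    ...     | r , refl =
      let M , g , ip , g0 , gM , g-inner =
            rec (s≤s (+-monoˡ-≤ r (m≤m+n (suc a) d))) (bypass f a d) (Walk-bypass a d r w fa~fb)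
                (λ e → f0≢fL (trans e (bypass-last f a d r))) (¬PfL ∘ subst P (bypass-last f a d r))
                (AllInner-bypass {P = P} {f = f} a d r inner)
      in M , g , ip , g0 , trans gM (bypass-last f a d r) , g-inner

Adj⇒≢ : ∀ {n} (G : Graph n) {x y} → Adj G x y → x ≢ y
Adj⇒≢ G x~y refl = irrefl G x~y

module _ {n} {G : Graph n} where

  AntiWalk-mono : ∀ {T T′ x y} → T ⊆ T′ → AntiWalk G T x y → AntiWalk G T′ x y
  AntiWalk-mono T⊆T′ here                   = here
  AntiWalk-mono T⊆T′ (step z∈T x≢z ¬x~z w) = step (T⊆T′ z∈T) x≢z ¬x~z (AntiWalk-mono T⊆T′ w)

  AntiWalk-++ : ∀ {T x y z} → AntiWalk G T x y → AntiWalk G T y z → AntiWalk G T x z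
  AntiWalk-++ here                     w′ = w′
  AntiWalk-++ (step z∈T x≢z ¬x~z w) w′ = step z∈T x≢z ¬x~z (AntiWalk-++ w w′)

  AntiWalk⇒Walk : ∀ {T x y} → AntiWalk G T x y →
    ∃₂ λ L f → f 0 ≡ x × f L ≡ y × Walk (complement G) f L × (∀ l → 0 < l → l ≤ L → f l ∈ T)
  AntiWalk⇒Walk {x = x} here = 0 , (λ _ → x) , refl , refl , (λ _ ()) , λ { (suc _) _ () }
  AntiWalk⇒Walk {T} {x} (step z∈T x≢z ¬x~z w) with AntiWalk⇒Walk w
  ... | L , f , f0 , fL , walk , inT = suc L , cons , refl , fL , walk′ , inT′
    where
    cons : ℕ → Fin n
    cons zero    = x
    cons (suc l) = f l
    walk′ : Walk (complement G) cons (suc L)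
    walk′ zero    _       = subst (Adj (complement G) x) (sym f0) (x≢z , ¬x~z)
    walk′ (suc a) a<L+1 = walk a (s≤s⁻¹ a<L+1)
    inT′ : ∀ l → 0 < l → l ≤ suc L → cons l ∈ T
    inT′ (suc zero)    _ _        = subst (_∈ T) (sym f0) z∈T
    inT′ (suc (suc l)) _ l+2≤L+1 = inT (suc l) (s≤s z≤n) (s≤s⁻¹ l+2≤L+1)

InC? : ∀ {n} (G : Graph n) T v → Dec (InC G T v)
InC? G T v = ¬? (v ∈? T) ×-dec all? (λ t → (t ∈? T) →-dec adj? G v t)

module _ {n} {G : Graph n} {T : Subset n} where

  ∉∈⇒≢ : ∀ {x t} → x ∉ T → t ∈ T → x ≢ t
  ∉∈⇒≢ x∉T t∈T refl = x∉T t∈T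

  ¬InC⇒non-neighbour : ∀ {v} → v ∉ T → ¬ InC G T v → ∃ λ t → t ∈ T × ¬ Adj G v t
  ¬InC⇒non-neighbour {v} v∉T ¬v∈C
    with ¬∀⟶∃¬ n (λ t → t ∈ T → Adj G v t) (λ t → (t ∈? T) →-dec adj? G v t) (λ v~T → ¬v∈C (v∉T , v~T))
  ... | t , ¬[t∈T⇒v~t] =
    t , decidable-stable (t ∈? T) (λ t∉T → ¬[t∈T⇒v~t] (λ t∈T → contradiction t∈T t∉T)) , ¬[t∈T⇒v~t] ∘ λ v~t _ → v~t

  ∈-∪⁅⁆ : ∀ {v w} → w ∈ T ∪ ⁅ v ⁆ → w ∈ T ⊎ w ≡ v
  ∈-∪⁅⁆ {v} w∈ = map₂ (Equivalence.to x∈⁅y⁆⇔x≡y) (x∈p∪q⁻ T ⁅ v ⁆ w∈)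

  Anticonnected-∪⁅⁆ : ∀ {v t} → Anticonnected G T → v ∉ T → t ∈ T → ¬ Adj G v t → Anticonnected G (T ∪ ⁅ v ⁆)
  Anticonnected-∪⁅⁆ {v} {t} (_ , walks) v∉T t∈T ¬v~t = (v , v∈T′) , walks′
    where
    T⊆T′ : T ⊆ T ∪ ⁅ v ⁆
    T⊆T′ = p⊆p∪q ⁅ v ⁆
    v∈T′ : v ∈ T ∪ ⁅ v ⁆
    v∈T′ = x∈p∪q⁺ (inj₂ (x∈⁅x⁆ v))
    lift : ∀ {a b} → a ∈ T → b ∈ T → AntiWalk G (T ∪ ⁅ v ⁆) a b
    lift a∈T b∈T = AntiWalk-mono T⊆T′ (walks _ _ a∈T b∈T)
    walks′ : ∀ a b → a ∈ T ∪ ⁅ v ⁆ → b ∈ T ∪ ⁅ v ⁆ → AntiWalk G (T ∪ ⁅ v ⁆) a b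
    walks′ a b a∈ b∈ with ∈-∪⁅⁆ a∈ | ∈-∪⁅⁆ b∈
    ... | inj₁ a∈T | inj₁ b∈T = lift a∈T b∈T
    ... | inj₁ a∈T | inj₂ refl =
      AntiWalk-++ (lift a∈T t∈T) (step v∈T′ (≢-sym (∉∈⇒≢ v∉T t∈T)) (¬v~t ∘ Graph.sym G) here)
    ... | inj₂ refl | inj₁ b∈T = step (T⊆T′ t∈T) (∉∈⇒≢ v∉T t∈T) ¬v~t (lift t∈T b∈T)
    ... | inj₂ refl | inj₂ refl = here

  InC-∪⁅⁆ : ∀ {a v} → InC G T a → Adj G a v → InC G (T ∪ ⁅ v ⁆) a
  InC-∪⁅⁆ (a∉T , a~T) a~v =
    [ a∉T , Adj⇒≢ G a~v ] ∘ ∈-∪⁅⁆ , λ t t∈ → [ a~T t , (λ { refl → a~v }) ] (∈-∪⁅⁆ t∈)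

  MaximalGood⇒common-neighbour-InC : MaximalGood G T → ∀ {a b v} → InC G T a → InC G T b → a ≢ b → ¬ Adj G a b →
    v ∉ T → Adj G a v → Adj G b v → InC G T v
  MaximalGood⇒common-neighbour-InC ((anticonnected , _) , maximal) {a} {b} {v} a∈C b∈C a≢b ¬a~b v∉T a~v b~v =
    decidable-stable (InC? G T v) λ ¬v∈C →
      let t , t∈T , ¬v~t = ¬InC⇒non-neighbour v∉T ¬v∈C
          good : Good G (T ∪ ⁅ v ⁆)
          good = Anticonnected-∪⁅⁆ anticonnected v∉T t∈T ¬v~t ,
                 a , b , InC-∪⁅⁆ a∈C a~v , InC-∪⁅⁆ b∈C b~v , a≢b , ¬a~b
      in v∉T (maximal (T ∪ ⁅ v ⁆) (p⊆p∪q ⁅ v ⁆) good (x∈p∪q⁺ (inj₂ (x∈⁅x⁆ v))))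

  non-neighbour-of-x₂⇒neighbour-of-x₃ : ¬ HasLongHole G → ∀ {x m} → InducedPath G x m → 2 < m →
    (∀ l → l ≤ m → x l ∉ T) → InC G T (x 0) → InC G T (x m) →
    ∀ {t} → t ∈ T → ¬ Adj G (x 2) t → Adj G (x 3) t
  non-neighbour-of-x₂⇒neighbour-of-x₃ noHole ip 2<m x∉T (_ , x₀~T) (_ , xₘ~T) t∈T ¬x₂~t =
    decidable-stable (adj? G _ _) λ ¬x₃~t →
      noHole (apex⇒HasLongHole G ip (λ l l≤m → ∉∈⇒≢ (x∉T l l≤m) t∈T) (x₀~T _ t∈T) (xₘ~T _ t∈T) ¬x₂~t ¬x₃~t 2<m)

  Anticonnected⇒complement-path : Anticonnected G T → ∀ {v w} → v ∉ T → w ∉ T → ¬ InC G T v → ¬ InC G T w → v ≢ w →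
    ∃₂ λ M g → InducedPath (complement G) g M × g 0 ≡ v × g M ≡ w × AllInner (_∈ T) g M
  Anticonnected⇒complement-path (_ , walks) {v} {w} v∉T w∉T ¬v∈C ¬w∈C v≢w
    with ¬InC⇒non-neighbour v∉T ¬v∈C | ¬InC⇒non-neighbour w∉T ¬w∈C
  ... | t , t∈T , ¬v~t | u , u∈T , ¬w~u
    with AntiWalk⇒Walk (step t∈T (∉∈⇒≢ v∉T t∈T) ¬v~t (walks t u t∈T u∈T))
  ... | L , f , f0 , fL , walk , f∈T =
    let M , g , ip , g0 , gM , g∈T = Walk⇒InducedPath (complement G) {P = _∈ T} (suc L) (snoc f L w)
                                        walk′ start≢end (w∉T ∘ subst (_∈ T) end) inner
    in M , g , ip , trans g0 start , trans gM end , g∈T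
    where
    start : snoc f L w 0 ≡ v
    start = trans (snoc-≤ f L w z≤n) f0
    end : snoc f L w (suc L) ≡ w
    end = snoc-suc f L w
    walk′ : Walk (complement G) (snoc f L w) (suc L)
    walk′ = Walk-snoc (complement G) walk
              (subst (λ z → Adj (complement G) z w) (sym fL) (≢-sym (∉∈⇒≢ w∉T u∈T) , ¬w~u ∘ Graph.sym G))
    start≢end : snoc f L w 0 ≢ snoc f L w (suc L)
    start≢end e = v≢w (trans (sym start) (trans e end))
    inner : AllInner (_∈ T) (snoc f L w) (suc L)
    inner l 0<l l<L+1 = subst (_∈ T) (sym (snoc-≤ f L w (s≤s⁻¹ l<L+1))) (f∈T l 0<l (s≤s⁻¹ l<L+1))

  long-gap⇒HasLongHole-complement : ¬ HasLongHole G → Anticonnected G T → ∀ {x m} → InducedPath G x m → 2 < m →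
    (∀ l → l ≤ m → x l ∉ T) → InC G T (x 0) → InC G T (x m) → ¬ InC G T (x 1) → ¬ InC G T (x 2) →
    HasLongHole (complement G)
  long-gap⇒HasLongHole-complement noHole anticonnected {x} {m} ip 2<m x∉T x₀∈C xₘ∈C ¬x₁∈C ¬x₂∈C =
    close (Anticonnected⇒complement-path anticonnected (x∉T 1 (≤m 1≤3)) (x∉T 2 (≤m 2≤3)) ¬x₁∈C ¬x₂∈C x₁≢x₂)
    where
    open InducedPath ip
    1≤3 : 1 ≤ 3
    1≤3 = s≤s z≤n
    2≤3 : 2 ≤ 3
    2≤3 = s≤s (s≤s z≤n)
    ≤m : ∀ {a} → a ≤ 3 → a ≤ m
    ≤m a≤3 = ≤-trans a≤3 2<m
    x₁≢x₂ : x 1 ≢ x 2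
    x₁≢x₂ = distinct 1 2 ≤-refl (≤m 2≤3)
    co-adj : ∀ a b → suc a < b → b ≤ 3 → Adj (complement G) (x a) (x b)
    co-adj a b a+1<b b≤3 = distinct a b (<-trans (n<1+n a) a+1<b) (≤m b≤3) ,
                       <⇒≢ a+1<b ∘ chordless a b (<-trans (n<1+n a) a+1<b) (≤m b≤3)
    close : (∃₂ λ M g → InducedPath (complement G) g M × g 0 ≡ x 1 × g M ≡ x 2 × AllInner (_∈ T) g M) →
            HasLongHole (complement G)
    close (zero , g , _ , g0 , g0′ , _) = contradiction (trans (sym g0) g0′) x₁≢x₂
    close (suc zero , g , ipg , g0 , g1 , _) =
      contradiction (subst₂ (Adj G) (sym g0) (sym g1) (walk 1 (≤m 2≤3))) (proj₂ (InducedPath.walk ipg 0 (s≤s z≤n)))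
    close (suc (suc M) , g , ipg , g0 , gM , g∈T) =
      apex⇒HasLongHole (complement G) ipF F≢x₃ F₀~x₃ F₃₊ₘ~x₃ ¬F₁₊ₘ~x₃ ¬F₂₊ₘ~x₃ (<-trans (n<1+n _) (n<1+n _))
      where
      F : ℕ → Fin n
      F = snoc g (suc (suc M)) (x 0)
      F-old : ∀ {l} → l ≤ suc (suc M) → F l ≡ g l
      F-old = snoc-≤ g (suc (suc M)) (x 0)
      F-new : F (suc (suc (suc M))) ≡ x 0
      F-new = snoc-suc g (suc (suc M)) (x 0)
      g-avoids : ∀ {v} → v ∉ T → v ≢ x 1 → v ≢ x 2 → ∀ l → l ≤ suc (suc M) → g l ≢ v
      g-avoids v∉T v≢x₁ v≢x₂ zero    _     e = v≢x₁ (trans (sym e) g0)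
      g-avoids v∉T v≢x₁ v≢x₂ (suc l) l<M+2 e with m≤1+n⇒m≤n⊎m≡1+n l<M+2
      ... | inj₁ l<M+1 = v∉T (subst (_∈ T) e (g∈T (suc l) (s≤s z≤n) (s≤s l<M+1)))
      ... | inj₂ refl  = v≢x₂ (trans (sym e) gM)
      ¬g~x₀ : ∀ l → l < suc (suc M) → ¬ Adj (complement G) (g l) (x 0)
      ¬g~x₀ zero    _       (_ , ¬g₀~x₀) = ¬g₀~x₀ (subst (λ z → Adj G z (x 0)) (sym g0) (Graph.sym G (walk 0 (≤m 1≤3))))
      ¬g~x₀ (suc l) l<M+1 (_ , ¬g~x₀) = ¬g~x₀ (Graph.sym G (proj₂ x₀∈C _ (g∈T (suc l) (s≤s z≤n) l<M+1)))
      ipF : InducedPath (complement G) F (suc (suc (suc M)))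
      ipF = InducedPath-snoc (complement G) ipg
              (g-avoids (x∉T 0 z≤n) (distinct 0 1 (s≤s z≤n) (≤m 1≤3)) (distinct 0 2 (s≤s z≤n) (≤m 2≤3)))
              (subst (λ z → Adj (complement G) z (x 0)) (sym gM) (Graph.sym (complement G) (co-adj 0 2 ≤-refl 2≤3)))
              ¬g~x₀
      F≢x₃ : ∀ l → l ≤ suc (suc (suc M)) → F l ≢ x 3
      F≢x₃ l l≤M+3 with m≤1+n⇒m≤n⊎m≡1+n l≤M+3
      ... | inj₁ l≤M+2 rewrite F-old l≤M+2 =
        g-avoids (x∉T 3 (≤m ≤-refl)) (≢-sym (distinct 1 3 2≤3 (≤m ≤-refl))) (≢-sym (distinct 2 3 ≤-refl (≤m ≤-refl))) l l≤M+2
      ... | inj₂ refl = distinct 0 3 (s≤s z≤n) (≤m ≤-refl) ∘ trans (sym F-new)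
      F₀~x₃ : Adj (complement G) (F 0) (x 3)
      F₀~x₃ = subst (λ z → Adj (complement G) z (x 3)) (sym (trans (F-old z≤n) g0)) (co-adj 1 3 ≤-refl ≤-refl)
      F₃₊ₘ~x₃ : Adj (complement G) (F (suc (suc (suc M)))) (x 3)
      F₃₊ₘ~x₃ = subst (λ z → Adj (complement G) z (x 3)) (sym F-new) (co-adj 0 3 (s≤s (s≤s z≤n)) ≤-refl)
      ¬F₁₊ₘ~x₃ : ¬ Adj (complement G) (F (suc M)) (x 3)
      ¬F₁₊ₘ~x₃ (_ , ¬F₁₊ₘ~x₃) = ¬F₁₊ₘ~x₃ $ subst (λ z → Adj G z (x 3)) (sym (F-old (n≤1+n _))) $ Graph.sym G $
        non-neighbour-of-x₂⇒neighbour-of-x₃ noHole ip 2<m x∉T x₀∈C xₘ∈C (g∈T (suc M) (s≤s z≤n) ≤-refl)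
          (λ x₂~g → proj₂ (InducedPath.walk ipg (suc M) ≤-refl) (subst (Adj G (g (suc M))) (sym gM) (Graph.sym G x₂~g)))
      ¬F₂₊ₘ~x₃ : ¬ Adj (complement G) (F (suc (suc M))) (x 3)
      ¬F₂₊ₘ~x₃ (_ , ¬x₂~x₃) = ¬x₂~x₃ (subst (λ z → Adj G z (x 3)) (sym (trans (F-old ≤-refl) gM)) (walk 2 (≤m ≤-refl)))

  no-InC-gap : WeaklyTriangulated G → MaximalGood G T → ∀ {x m} → InducedPath G x m → 2 ≤ m →
    (∀ l → l ≤ m → x l ∉ T) → InC G T (x 0) → InC G T (x m) → ¬ AllInner (¬_ ∘ InC G T) x m
  no-InC-gap _ _ {m = 1} _ (s≤s ())
  no-InC-gap _ maximal {x} {2} ip _ x∉T x₀∈C x₂∈C gap =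
    gap 1 (s≤s z≤n) ≤-refl $
      MaximalGood⇒common-neighbour-InC maximal x₀∈C x₂∈C (distinct 0 2 (s≤s z≤n) ≤-refl)
        (λ x₀~x₂ → contradiction (chordless 0 2 (s≤s z≤n) ≤-refl x₀~x₂) λ ())
        (x∉T 1 (s≤s z≤n)) (walk 0 (s≤s z≤n)) (Graph.sym G (walk 1 ≤-refl))
    where open InducedPath ip
  no-InC-gap (noHole , noAntihole) ((anticonnected , _) , _) {x} {suc (suc (suc m))} ip _ x∉T x₀∈C xₘ∈C gap =
    noAntihole $ HasLongHole-complement⇒HasLongAntihole G $
      long-gap⇒HasLongHole-complement noHole anticonnected ip (s≤s (s≤s (s≤s z≤n))) x∉T x₀∈C xₘ∈C
        (gap 1 (s≤s z≤n) (s≤s (s≤s z≤n))) (gap 2 (s≤s z≤n) (s≤s (s≤s (s≤s z≤n))))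

-- junk value zero beyond k
clamp : ∀ k → ℕ → Fin (suc k)
clamp k l with l <? suc k
... | yes l<k+1 = fromℕ< l<k+1
... | no _ = zero

toℕ-clamp : ∀ {k l} → l ≤ k → toℕ (clamp k l) ≡ l
toℕ-clamp {k} {l} l≤k with l <? suc k
... | yes l<k+1 = toℕ-fromℕ< l<k+1
... | no l≮k+1 = contradiction (s≤s l≤k) l≮k+1

clamp-toℕ : ∀ {k} (i : Fin (suc k)) → clamp k (toℕ i) ≡ i
clamp-toℕ {k} i with toℕ i <? suc k
... | yes i<k+1 = fromℕ<-toℕ i i<k+1
... | no i≮k+1 = contradiction (toℕ<n i) i≮k+1

IsInducedPath⇒InducedPath : ∀ {n} {G : Graph n} {k p} → IsInducedPath G k p → InducedPath G (p ∘ clamp k) k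
IsInducedPath⇒InducedPath {G = G} {k} {p} (p-injective , induced) = record
  { distinct  = λ a b a<b b≤k e → <⇒≢ a<b (begin
      a                ≡⟨ sym (toℕ-clamp (≤-trans (<⇒≤ a<b) b≤k)) ⟩
      toℕ (clamp k a)  ≡⟨ cong toℕ (p-injective e) ⟩
      toℕ (clamp k b)  ≡⟨ toℕ-clamp b≤k ⟩
      b                ∎)
  ; chordless = chordless
  ; walk      = λ a a<k → proj₂ (induced (clamp k a) (clamp k (suc a)))
                  (inj₁ (trans (cong suc (toℕ-clamp (<⇒≤ a<k))) (sym (toℕ-clamp a<k))))
  }
  where
  open ≡-Reasoning
  chordless : ∀ a b → a < b → b ≤ k → Adj G (p (clamp k a)) (p (clamp k b)) → suc a ≡ b
  chordless a b a<b b≤k pa~pb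
    with toℕ (clamp k a) | toℕ-clamp {k} (≤-trans (<⇒≤ a<b) b≤k) | toℕ (clamp k b) | toℕ-clamp {k} b≤k
       | proj₁ (induced (clamp k a) (clamp k b)) pa~pb
  ... | _ | refl | _ | refl | inj₁ a+1≡b = a+1≡b
  ... | _ | refl | _ | refl | inj₂ b+1≡a = contradiction a<b (<⇒≯ (subst (b <_) b+1≡a (n<1+n b)))

lemmal : ∀ {n} (G : Graph n) (T : Subset n) → WeaklyTriangulated G → MaximalGood G T →
    (k : ℕ) (p : Fin (suc k) → Fin n) → IsInducedPath G k p → (∀ i → p i ∉ T) →
    InC G T (p zero) → InC G T (p (fromℕ k)) → ∀ i → InC G T (p i)
lemmal G T weaklyTriangulated maximal k p p-induced p∉T p₀∈C pₖ∈C i =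
  subst (InC G T ∘ p) (clamp-toℕ i) (x∈C (s≤s⁻¹ (toℕ<n i)))
  where
  x : ℕ → Fin _
  x = p ∘ clamp k
  x₀∈C : InC G T (x 0)
  x₀∈C = subst (InC G T ∘ p) (sym (clamp-toℕ zero)) p₀∈C
  xₖ∈C : InC G T (x k)
  xₖ∈C = subst (InC G T ∘ p ∘ clamp k) (toℕ-fromℕ k) (subst (InC G T ∘ p) (sym (clamp-toℕ (fromℕ k))) pₖ∈C)
  x∈C : ∀ {l} → l ≤ k → InC G T (x l)
  x∈C {l} l≤k = decidable-stable (InC? G T (x l)) λ ¬xₗ∈C →
    let j , m , j<l , l<j+m , j+m≤k , xⱼ∈C , xⱼ₊ₘ∈C , gap = gap-around (InC? G T ∘ x) x₀∈C xₖ∈C ¬xₗ∈C l≤k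
    in no-InC-gap weaklyTriangulated maximal (InducedPath-drop G j (IsInducedPath⇒InducedPath p-induced) j+m≤k)
         (+-cancelˡ-≤ j 2 m (subst (_≤ j + m) (+-comm 2 j) (≤-trans (s≤s j<l) l<j+m)))
         (λ _ _ → p∉T _) (subst (InC G T ∘ x) (sym (+-identityʳ j)) xⱼ∈C) xⱼ₊ₘ∈C gap
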